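{- Let $M$ be a matroid of rank $r$ on $[n]$ and let $\mathbf{w}_1,\mathbf{w}_2,\mathbf{w}_3,\mathbf{w}_4$ be vertices of $\mathcal{P}_M$ such that $\mathbf{w}_1$ and $\mathbf{w}_4$ are each adjacent to $\mathbf{w}_2$ and to $\mathbf{w}_3$ in $\mathcal{P}_M$, where $\mathbf{w}_2=\mathbf{w}_1+(\mathbf{e}_s-\mathbf{e}_t)$, $\mathbf{w}_3=\mathbf{w}_1+(\mathbf{e}_m-\mathbf{e}_l)$, $\mathbf{w}_4=\mathbf{w}_1+(\mathbf{e}_s-\mathbf{e}_t)+(\mathbf{e}_m-\mathbf{e}_l)$, with $\mathbf{e}_s\ne\mathbf{e}_m$, $\mathbf{e}_t\ne\mathbf{e}_l$, $\mathbf{e}_s\ne\mathbf{e}_t$, $\mathbf{e}_m\ne\mathbf{e}_l$. Then $\mathbf{w}_1,\mathbf{w}_2,\mathbf{w}_3,\mathbf{w}_4$ are the vertices of a square $2$-dimensional face of $\mathcal{P}_M$ if and only if at least one of $\mathbf{w}_5:=\mathbf{w}_1+(\mathbf{e}_s-\mathbf{e}_l)$ and $\mathbf{w}_6:=\mathbf{w}_1+(\mathbf{e}_m-\mathbf{e}_t)$ is not a vertex of $\mathcal{P}_M$.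
   Context: For a matroid $M$ on $[n]$ with bases $\mathcal{B}_M$, $\mathcal{P}_M=\operatorname{conv}\{\mathbf{e}_B:B\in\mathcal{B}_M\}$ with $\mathbf{e}_B=\sum_{i\in B}\mathbf{e}_i$. Two vertices of a polytope are adjacent if they are the endpoints of an edge ($1$-dimensional face). -}

module Defs where

open import Data.Nat using (ℕ; zero; suc)
open import Data.Integer using (ℤ; _+_; _-_; _*_; _≤_; 0ℤ; 1ℤ)
open import Data.Fin using (Fin; zero; suc)
open import Data.Fin.Subset using (Subset; _∈_; _∉_; _∪_; _─_; ⁅_⁆; ∣_∣)
open import Data.Vec using (lookup)
open import Data.Bool using (if_then_else_)
open import Data.Product using (Σ; ∃; _×_)
open import Data.Sum using (_⊎_)
open import Relation.Binary.PropositionalEquality using (_≡_)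
open import Relation.Nullary using (¬_)
open import Function.Bundles using (_⇔_)

record Matroid (n : ℕ) : Set₁ where
  field
    IsBasis  : Subset n → Set
    nonempty : ∃ λ B → IsBasis B
    exchange : ∀ B₁ B₂ → IsBasis B₁ → IsBasis B₂ → ∀ x → x ∈ B₁ → x ∉ B₂ →
               ∃ λ y → y ∈ B₂ × y ∉ B₁ × IsBasis ((B₁ ─ ⁅ x ⁆) ∪ ⁅ y ⁆)
open Matroid public

HasRank : ∀ {n} → Matroid n → ℕ → Set
HasRank M r = ∀ B → IsBasis M B → ∣ B ∣ ≡ r

-- Points of ℤⁿ (all vertices of P_M are integral).
Point : ℕ → Set
Point n = Fin n → ℤ

_≈_ : ∀ {n} → Point n → Point n → Set
v ≈ w = ∀ i → v i ≡ w i

_⊕_ : ∀ {n} → Point n → Point n → Point n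
(v ⊕ w) i = v i + w i

_⊖_ : ∀ {n} → Point n → Point n → Point n
(v ⊖ w) i = v i - w i

𝐞 : ∀ {n} → Fin n → Point n
𝐞 zero    zero    = 1ℤ
𝐞 zero    (suc j) = 0ℤ
𝐞 (suc i) zero    = 0ℤ
𝐞 (suc i) (suc j) = 𝐞 i j

𝐞[_] : ∀ {n} → Subset n → Point n
𝐞[ B ] i = if lookup B i then 1ℤ else 0ℤ

dot : ∀ {n} → Point n → Point n → ℤ
dot {zero}  c v = 0ℤ
dot {suc n} c v = c zero * v zero + dot {n} (λ i → c (suc i)) (λ i → v (suc i))

-- B maximizes the linear functional c over the vertices e_B' of P_M
Maximizes : ∀ {n} → Matroid n → Point n → Subset n → Set
Maximizes M c B = ∀ B′ → IsBasis M B′ → dot c 𝐞[ B′ ] ≤ dot c 𝐞[ B ]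

-- The face of P_M cut out by the linear functional c (the set of points of
-- P_M maximizing c) has vertex set exactly S: the vertices e_B of P_M lying
-- on the face are exactly the points of S, and every point of S is such a vertex.
-- (A face of conv(V) is conv of the c-maximizers in V, so its vertices are those maximizers.)
FaceWithVertices : ∀ {n} → Matroid n → Point n → (Point n → Set) → Set
FaceWithVertices M c S =
  (∀ B → IsBasis M B → (Maximizes M c B ⇔ S 𝐞[ B ])) ×
  (∀ w → S w → ∃ λ B → IsBasis M B × (𝐞[ B ] ≈ w))

IsVertex : ∀ {n} → Matroid n → Point n → Set
IsVertex M w = ∃ λ c → FaceWithVertices M c (λ v → v ≈ w)

Adjacent : ∀ {n} → Matroid n → Point n → Point n → Set
Adjacent M v w = ¬ (v ≈ w) × ∃ λ c → FaceWithVertices M c (λ u → u ≈ v ⊎ u ≈ w)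

IsFaceWithVertices4 : ∀ {n} → Matroid n → Point n → Point n → Point n → Point n → Set
IsFaceWithVertices4 M w₁ w₂ w₃ w₄ =
  ∃ λ c → FaceWithVertices M c (λ u → u ≈ w₁ ⊎ u ≈ w₂ ⊎ u ≈ w₃ ⊎ u ≈ w₄)

module Submission where

-- Write w₁ = e_B for a basis B.  Since w₂ and w₃ are 0/1-vectors, B contains
-- t and l but neither s nor m, so w₁,…,w₆ agree outside the four "square"
-- coordinates (s,t,m,l), where their profiles are w₁ = 0101, w₂ = 1001,
-- w₃ = 0110, w₄ = 1010, w₅ = 1100 and w₆ = 0011.
--
-- (⇒) A functional c cutting out the face {w₁,…,w₄} has c_s = c_t and
-- c_m = c_l, hence (c_s − c_l) + (c_m − c_t) = 0; so w₅ or w₆ has c-value at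
-- least the maximum and, were it a vertex, it would be a fifth vertex of the face.
-- (⇐) If w₅ is not a vertex, let c = 2c₀ + e_s + e_t, where c₀ is the sign
-- vector of B outside the square and 0 on it.  A c₀-maximal basis agrees with
-- B outside the square, so (all bases having the same size) its profile has
-- two ones; with 1100 excluded, x_s + x_t ≤ 1, with equality exactly for the
-- four profiles of w₁,…,w₄.  If w₆ is not a vertex, exchange (s,t) and (m,l).

open import Defs
open import Data.Nat using (ℕ; zero; suc; z≤n; s≤s)
open import Data.Fin using (Fin; zero; suc)
open import Data.Fin.Properties using (_≟_)
open import Data.Fin.Subset using (Subset; ∣_∣)
open import Data.Bool using (true; false)
open import Data.Vec using ([]; _∷_; lookup)
open import Data.Integer using (ℤ; +_; _+_; _-_; _*_; _≤_; _<_; 0ℤ; 1ℤ; -1ℤ; +≤+; -≤+; +<+)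
import Data.Integer.Properties as ℤ
open import Data.Integer.Tactic.RingSolver using (solve-∀)
open import Algebra.Properties.AbelianGroup ℤ.+-0-abelianGroup using (∙-cancelˡ; ∙-cancelʳ)
open import Data.Product using (∃; _×_; _,_; proj₁; proj₂)
open import Data.Sum using (_⊎_; inj₁; inj₂; map)
open import Data.Sum.Function.Propositional using (_⊎-⇔_)
open import Data.Empty using (⊥-elim)
open import Function.Bundles using (_⇔_; mk⇔; Equivalence)
import Function.Properties.Equivalence as ⇔
open import Relation.Nullary using (¬_; yes; no)
open import Relation.Binary.PropositionalEquality

≈-refl : ∀ {n} {x : Point n} → x ≈ x
≈-refl i = refl

≈-sym : ∀ {n} {x y : Point n} → x ≈ y → y ≈ x
≈-sym x≈y i = sym (x≈y i)

≈-trans : ∀ {n} {x y z : Point n} → x ≈ y → y ≈ z → x ≈ z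
≈-trans x≈y y≈z i = trans (x≈y i) (y≈z i)

⊕-congˡ : ∀ {n} {x y : Point n} (z : Point n) → x ≈ y → (x ⊕ z) ≈ (y ⊕ z)
⊕-congˡ z x≈y i = cong (_+ z i) (x≈y i)

dot-comm : ∀ {n} (x y : Point n) → dot x y ≡ dot y x
dot-comm {zero}  x y = refl
dot-comm {suc n} x y = cong₂ _+_ (ℤ.*-comm (x zero) (y zero)) (dot-comm {n} _ _)

dot-⊕ʳ : ∀ {n} (c x y : Point n) → dot c (x ⊕ y) ≡ dot c x + dot c y
dot-⊕ʳ {zero}  c x y = refl
dot-⊕ʳ {suc n} c x y =
  trans (cong (_+_ (c zero * (x zero + y zero))) (dot-⊕ʳ {n} _ _ _)) (distrib (c zero) (x zero) (y zero) _ _)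
  where
  distrib : ∀ a u v p q → a * (u + v) + (p + q) ≡ (a * u + p) + (a * v + q)
  distrib = solve-∀

dot-⊖ʳ : ∀ {n} (c x y : Point n) → dot c (x ⊖ y) ≡ dot c x - dot c y
dot-⊖ʳ {zero}  c x y = refl
dot-⊖ʳ {suc n} c x y =
  trans (cong (_+_ (c zero * (x zero - y zero))) (dot-⊖ʳ {n} _ _ _)) (distrib (c zero) (x zero) (y zero) _ _)
  where
  distrib : ∀ a u v p q → a * (u - v) + (p - q) ≡ (a * u + p) - (a * v + q)
  distrib = solve-∀

dot-⊕ˡ : ∀ {n} (c d x : Point n) → dot (c ⊕ d) x ≡ dot c x + dot d x
dot-⊕ˡ c d x = trans (dot-comm (c ⊕ d) x) (trans (dot-⊕ʳ x c d) (cong₂ _+_ (dot-comm x c) (dot-comm x d)))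

dot-0ʳ : ∀ {n} (c : Point n) → dot c (λ _ → 0ℤ) ≡ 0ℤ
dot-0ʳ {zero}  c = refl
dot-0ʳ {suc n} c =
  trans (cong (_+_ (c zero * 0ℤ)) (dot-0ʳ {n} _)) (trans (ℤ.+-identityʳ _) (ℤ.*-zeroʳ (c zero)))

dot-eʳ : ∀ {n} (c : Point n) j → dot c (𝐞 j) ≡ c j
dot-eʳ {suc n} c zero =
  trans (cong (_+_ (c zero * 1ℤ)) (dot-0ʳ {n} _)) (trans (ℤ.+-identityʳ _) (ℤ.*-identityʳ (c zero)))
dot-eʳ {suc n} c (suc j) =
  trans (cong₂ _+_ (ℤ.*-zeroʳ (c zero)) (dot-eʳ {n} _ j)) (ℤ.+-identityˡ _)

dot-eˡ : ∀ {n} (x : Point n) j → dot (𝐞 j) x ≡ x j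
dot-eˡ x j = trans (dot-comm (𝐞 j) x) (dot-eʳ x j)

dot-shift : ∀ {n} (c x : Point n) j k → dot c (x ⊕ (𝐞 j ⊖ 𝐞 k)) ≡ dot c x + (c j - c k)
dot-shift c x j k =
  trans (dot-⊕ʳ c x _) (cong (_+_ (dot c x)) (trans (dot-⊖ʳ c _ _) (cong₂ _-_ (dot-eʳ c j) (dot-eʳ c k))))

dot-mono : ∀ {n} (c x c′ y : Point n) →
           (∀ i → c i * x i ≤ c′ i * y i) → dot c x ≤ dot c′ y
dot-mono {zero}  c x c′ y le = ℤ.≤-refl
dot-mono {suc n} c x c′ y le = ℤ.+-mono-≤ (le zero) (dot-mono {n} _ _ _ _ (λ i → le (suc i)))

dot-agree : ∀ {n} (c x c′ y : Point n) →
            (∀ i → c i * x i ≡ c′ i * y i) → dot c x ≡ dot c′ y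
dot-agree c x c′ y eq = ℤ.≤-antisym (dot-mono c x c′ y (λ i → ℤ.≤-reflexive (eq i)))
                                    (dot-mono c′ y c x (λ i → ℤ.≤-reflexive (sym (eq i))))

dot-cong : ∀ {n} (c : Point n) {x y : Point n} → x ≈ y → dot c x ≡ dot c y
dot-cong c {x} {y} x≈y = dot-agree c x c y (λ i → cong (c i *_) (x≈y i))

zero-coefficient : ∀ {k x y : ℤ} → k ≡ 0ℤ → k * x ≡ k * y
zero-coefficient {x = x} {y} refl = trans (ℤ.*-zeroˡ x) (sym (ℤ.*-zeroˡ y))

+-split : ∀ {a b A B : ℤ} → a ≤ b → A ≤ B → a + A ≡ b + B → a ≡ b × A ≡ B
+-split {a} {b} a≤b A≤B eq with a ℤ.≟ b
... | yes refl = refl , ∙-cancelˡ a _ _ eq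
... | no  a≢b  = ⊥-elim (ℤ.<-irrefl eq (ℤ.+-mono-<-≤ (ℤ.≤∧≢⇒< a≤b a≢b) A≤B))

dot-tight : ∀ {n} (c x y : Point n) → (∀ i → c i * x i ≤ c i * y i) → dot c x ≡ dot c y →
            ∀ i → c i * x i ≡ c i * y i
dot-tight {suc n} c x y le eq i with +-split (le zero) (dot-mono {n} _ _ _ _ (λ j → le (suc j))) eq
dot-tight {suc n} c x y le eq zero    | head , _    = head
dot-tight {suc n} c x y le eq (suc i) | _    , tail = dot-tight {n} _ _ _ (λ j → le (suc j)) tail i

𝐞-same : ∀ {n} (j : Fin n) → 𝐞 j j ≡ 1ℤ
𝐞-same zero    = refl
𝐞-same (suc j) = 𝐞-same j

𝐞-diff : ∀ {n} {i j : Fin n} → i ≢ j → 𝐞 j i ≡ 0ℤ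
𝐞-diff {i = zero}  {zero}  i≢j = ⊥-elim (i≢j refl)
𝐞-diff {i = zero}  {suc j} i≢j = refl
𝐞-diff {i = suc i} {zero}  i≢j = refl
𝐞-diff {i = suc i} {suc j} i≢j = 𝐞-diff (λ i≡j → i≢j (cong suc i≡j))

shift-source : ∀ {n} (x : Point n) {j k} → j ≢ k → (x ⊕ (𝐞 j ⊖ 𝐞 k)) j ≡ x j + 1ℤ
shift-source x {j} {k} j≢k = cong (_+_ (x j)) (cong₂ _-_ (𝐞-same j) (𝐞-diff j≢k))

shift-target : ∀ {n} (x : Point n) {j k} → j ≢ k → (x ⊕ (𝐞 j ⊖ 𝐞 k)) k ≡ x k - 1ℤ
shift-target x {j} {k} j≢k = cong (_+_ (x k)) (cong₂ _-_ (𝐞-diff (≢-sym j≢k)) (𝐞-same k))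

Is01 : ℤ → Set
Is01 x = x ≡ 0ℤ ⊎ x ≡ 1ℤ

0≢1 : 0ℤ ≢ 1ℤ
0≢1 ()

up-01 : ∀ {x} → Is01 x → Is01 (x + 1ℤ) → x ≡ 0ℤ
up-01 (inj₁ refl) _           = refl
up-01 (inj₂ refl) (inj₁ ())
up-01 (inj₂ refl) (inj₂ ())

down-01 : ∀ {x} → Is01 x → Is01 (x - 1ℤ) → x ≡ 1ℤ
down-01 (inj₁ refl) (inj₁ ())
down-01 (inj₁ refl) (inj₂ ())
down-01 (inj₂ refl) _           = refl

sum01≤2 : ∀ {a b} → Is01 a → Is01 b → a + b ≤ + 2
sum01≤2 (inj₁ refl) (inj₁ refl) = +≤+ z≤n
sum01≤2 (inj₁ refl) (inj₂ refl) = +≤+ (s≤s z≤n)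
sum01≤2 (inj₂ refl) (inj₁ refl) = +≤+ (s≤s z≤n)
sum01≤2 (inj₂ refl) (inj₂ refl) = ℤ.≤-refl

below-succ : ∀ a → a < a + 1ℤ
below-succ a = ℤ.suc[i]≤j⇒i<j (ℤ.≤-reflexive (ℤ.+-comm 1ℤ a))

double-below : ∀ {D V σ} → D < V → σ ≤ + 2 → (D + D) + σ < (V + V) + 1ℤ
double-below {D} {V} {σ} D<V σ≤2 = ℤ.≤-<-trans bound (below-succ (V + V))
  where
  regroup : ∀ d → (d + d) + + 2 ≡ (1ℤ + d) + (1ℤ + d)
  regroup = solve-∀
  D+1≤V : 1ℤ + D ≤ V
  D+1≤V = ℤ.i<j⇒suc[i]≤j D<V
  bound : (D + D) + σ ≤ V + V
  bound = ℤ.≤-trans (ℤ.+-monoʳ-≤ (D + D) σ≤2)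
            (ℤ.≤-trans (ℤ.≤-reflexive (regroup D)) (ℤ.+-mono-≤ D+1≤V D+1≤V))

strictly-below : ∀ {A : Set} {y top : ℤ} → y < top → y ≤ top × (y ≡ top → A)
strictly-below y<top = ℤ.<⇒≤ y<top , λ y≡top → ⊥-elim (ℤ.<⇒≢ y<top y≡top)

indicator-01 : ∀ {n} (B : Subset n) i → Is01 (𝐞[ B ] i)
indicator-01 B i with lookup B i
... | true  = inj₂ refl
... | false = inj₁ refl

𝟙 : ∀ {n} → Point n
𝟙 _ = 1ℤ

dot-𝟙 : ∀ {n} (B : Subset n) → dot 𝟙 𝐞[ B ] ≡ + ∣ B ∣
dot-𝟙 []          = refl
dot-𝟙 (true ∷ B)  = cong (_+_ 1ℤ) (dot-𝟙 B)
dot-𝟙 (false ∷ B) = trans (ℤ.+-identityˡ _) (dot-𝟙 B)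

sign : ∀ {n} → Subset n → Point n
sign B i with lookup B i
... | true  = 1ℤ
... | false = -1ℤ

sign-bound : ∀ {n} (B X : Subset n) i → sign B i * 𝐞[ X ] i ≤ sign B i * 𝐞[ B ] i
sign-bound B X i with lookup B i | lookup X i
... | true  | true  = ℤ.≤-refl
... | true  | false = +≤+ z≤n
... | false | true  = -≤+
... | false | false = ℤ.≤-refl

sign-tight : ∀ {n} (B X : Subset n) i → sign B i * 𝐞[ X ] i ≡ sign B i * 𝐞[ B ] i → 𝐞[ X ] i ≡ 𝐞[ B ] i
sign-tight B X i with lookup B i | lookup X i
... | true  | true  = λ _ → refl
... | true  | false = λ ()
... | false | true  = λ ()
... | false | false = λ _ → refl

vertex⇒basis : ∀ {n} {M : Matroid n} {w : Point n} → IsVertex M w → ∃ λ X → IsBasis M X × 𝐞[ X ] ≈ w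
vertex⇒basis (_ , _ , realised) = realised _ ≈-refl

vertex-01 : ∀ {n} {M : Matroid n} {w : Point n} → IsVertex M w → ∀ i → Is01 (w i)
vertex-01 {M = M} v i with vertex⇒basis {M = M} v
... | X , _ , eX≈w = subst Is01 (eX≈w i) (indicator-01 X i)

-- Every basis gives a vertex: sign B cuts out e_B alone.
basis⇒vertex : ∀ {n} (M : Matroid n) {X : Subset n} {w : Point n} → IsBasis M X → 𝐞[ X ] ≈ w → IsVertex M w
basis⇒vertex M {X} {w} X-basis eX≈w =
  sign X , (λ Y _ → mk⇔ (to Y) (from Y)) , λ u u≈w → X , X-basis , ≈-trans eX≈w (≈-sym u≈w)
  where
  bound : ∀ Y → dot (sign X) 𝐞[ Y ] ≤ dot (sign X) 𝐞[ X ]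
  bound Y = dot-mono _ _ _ _ (sign-bound X Y)
  to : ∀ Y → Maximizes M (sign X) Y → 𝐞[ Y ] ≈ w
  to Y Y-max = ≈-trans (λ i → sign-tight X Y i (dot-tight (sign X) 𝐞[ Y ] 𝐞[ X ] (sign-bound X Y)
                 (ℤ.≤-antisym (bound Y) (Y-max X X-basis)) i)) eX≈w
  from : ∀ Y → 𝐞[ Y ] ≈ w → Maximizes M (sign X) Y
  from Y eY≈w Z _ = ℤ.≤-trans (bound Z) (ℤ.≤-reflexive (dot-cong (sign X) (≈-trans eX≈w (≈-sym eY≈w))))

vertex-resp : ∀ {n} {M : Matroid n} {v w : Point n} → v ≈ w → IsVertex M v → IsVertex M w
vertex-resp {M = M} v≈w v with vertex⇒basis {M = M} v
... | X , X-basis , eX≈v = basis⇒vertex M X-basis (≈-trans eX≈v v≈w)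

¬vertex-⇔ : ∀ {n} {M : Matroid n} {v w : Point n} → v ≈ w → (¬ IsVertex M v) ⇔ (¬ IsVertex M w)
¬vertex-⇔ {M = M} v≈w =
  mk⇔ (λ ¬v w → ¬v (vertex-resp {M = M} (≈-sym v≈w) w)) (λ ¬w v → ¬w (vertex-resp {M = M} v≈w v))

face-resp : ∀ {n} {M : Matroid n} {c : Point n} {S S′ : Point n → Set} →
            (∀ u → S u ⇔ S′ u) → FaceWithVertices M c S → FaceWithVertices M c S′
face-resp S⇔S′ (maximal , realised) =
  (λ X X-basis → ⇔.trans (maximal X X-basis) (S⇔S′ _)) ,
  (λ u u∈S′ → realised u (Equivalence.from (S⇔S′ u) u∈S′))

≈-target : ∀ {n} {u a a′ : Point n} → a ≈ a′ → (u ≈ a) ⇔ (u ≈ a′)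
≈-target a≈a′ = mk⇔ (λ u≈a → ≈-trans u≈a a≈a′) (λ u≈a′ → ≈-trans u≈a′ (≈-sym a≈a′))

face4-resp : ∀ {n} {M : Matroid n} {a b c d a′ b′ c′ d′ : Point n} → a ≈ a′ → b ≈ b′ → c ≈ c′ → d ≈ d′ →
             IsFaceWithVertices4 M a b c d ⇔ IsFaceWithVertices4 M a′ b′ c′ d′
face4-resp {M = M} {a} {b} {c} {d} {a′} {b′} {c′} {d′} a≈a′ b≈b′ c≈c′ d≈d′ =
  mk⇔ (λ (f , face) → f , face-resp {M = M} same face)
      (λ (f , face) → f , face-resp {M = M} (λ u → ⇔.sym (same u)) face)
  where
  same : ∀ u → (u ≈ a ⊎ u ≈ b ⊎ u ≈ c ⊎ u ≈ d) ⇔ (u ≈ a′ ⊎ u ≈ b′ ⊎ u ≈ c′ ⊎ u ≈ d′)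
  same u = ≈-target a≈a′ ⊎-⇔ ≈-target b≈b′ ⊎-⇔ ≈-target c≈c′ ⊎-⇔ ≈-target d≈d′

face4-swap : ∀ {n} {M : Matroid n} {a b c d : Point n} →
             IsFaceWithVertices4 M a b c d → IsFaceWithVertices4 M a c b d
face4-swap {M = M} (f , face) = f , face-resp {M = M} (λ _ → mk⇔ swap swap) face
  where
  swap : ∀ {A B C D : Set} → A ⊎ B ⊎ C ⊎ D → A ⊎ C ⊎ B ⊎ D
  swap (inj₁ a)               = inj₁ a
  swap (inj₂ (inj₁ b))        = inj₂ (inj₂ (inj₁ b))
  swap (inj₂ (inj₂ (inj₁ c))) = inj₂ (inj₁ c)
  swap (inj₂ (inj₂ (inj₂ d))) = inj₂ (inj₂ (inj₂ d))

Respects≈ : ∀ {n} → (Point n → Set) → Set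
Respects≈ S = ∀ {u v} → u ≈ v → S u → S v

four-respects : ∀ {n} {a b c d : Point n} → Respects≈ (λ u → u ≈ a ⊎ u ≈ b ⊎ u ≈ c ⊎ u ≈ d)
four-respects {u = u} {v} u≈v = map moved (map moved (map moved moved))
  where
  moved : ∀ {x} → u ≈ x → v ≈ x
  moved u≈x = ≈-trans (≈-sym u≈v) u≈x

face-maximiser : ∀ {n} {M : Matroid n} {c : Point n} {S : Point n → Set} → FaceWithVertices M c S →
                 Respects≈ S → ∀ {u} → S u → ∃ λ X → IsBasis M X × 𝐞[ X ] ≈ u × Maximizes M c X
face-maximiser (maximal , realised) resp u∈S with realised _ u∈S
... | X , X-basis , eX≈u = X , X-basis , eX≈u , Equivalence.from (maximal X X-basis) (resp (≈-sym eX≈u) u∈S)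

face-level : ∀ {n} {M : Matroid n} {c : Point n} {S : Point n → Set} → FaceWithVertices M c S →
             Respects≈ S → ∀ {u v} → S u → S v → dot c u ≡ dot c v
face-level {M = M} {c} face resp u∈S v∈S
  with face-maximiser {M = M} face resp u∈S | face-maximiser {M = M} face resp v∈S
... | X , X-basis , eX≈u , X-max | Y , Y-basis , eY≈v , Y-max =
  trans (sym (dot-cong c eX≈u)) (trans (ℤ.≤-antisym (Y-max X X-basis) (X-max Y Y-basis)) (dot-cong c eY≈v))

vertex-in-face : ∀ {n} {M : Matroid n} {c : Point n} {S : Point n → Set} → FaceWithVertices M c S →
                 Respects≈ S → ∀ {u w} → S u → IsVertex M w → dot c u ≤ dot c w → S w
vertex-in-face {M = M} {c} face@(maximal , _) resp u∈S w-vertex u≤w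
  with face-maximiser {M = M} face resp u∈S | vertex⇒basis {M = M} w-vertex
... | X , _ , eX≈u , X-max | Y , Y-basis , eY≈w =
  resp eY≈w (Equivalence.to (maximal Y Y-basis) Y-max)
  where
  Y-max : Maximizes M c Y
  Y-max Z Z-basis = ℤ.≤-trans (X-max Z Z-basis)
    (ℤ.≤-trans (ℤ.≤-reflexive (dot-cong c eX≈u)) (ℤ.≤-trans u≤w (ℤ.≤-reflexive (sym (dot-cong c eY≈w)))))

face-criterion : ∀ {n} (M : Matroid n) (c : Point n) (S : Point n → Set) (top : ℤ) →
  (∀ X → IsBasis M X → dot c 𝐞[ X ] ≤ top × (dot c 𝐞[ X ] ≡ top → S 𝐞[ X ])) →
  (∀ u → S u → dot c u ≡ top) →
  (∀ u → S u → ∃ λ X → IsBasis M X × 𝐞[ X ] ≈ u) →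
  ∀ {u₀} → S u₀ → FaceWithVertices M c S
face-criterion M c S top bound on-top realised {u₀} u₀∈S =
  (λ X X-basis → mk⇔ (to X X-basis) (from X)) , realised
  where
  to : ∀ X → IsBasis M X → Maximizes M c X → S 𝐞[ X ]
  to X X-basis X-max with realised u₀ u₀∈S
  ... | X₀ , X₀-basis , eX₀≈u₀ =
    proj₂ (bound X X-basis) (ℤ.≤-antisym (proj₁ (bound X X-basis))
      (ℤ.≤-trans (ℤ.≤-reflexive (sym (trans (dot-cong c eX₀≈u₀) (on-top u₀ u₀∈S)))) (X-max X₀ X₀-basis)))
  from : ∀ X → S 𝐞[ X ] → Maximizes M c X
  from X X∈S Y Y-basis = ℤ.≤-trans (proj₁ (bound Y Y-basis)) (ℤ.≤-reflexive (sym (on-top _ X∈S)))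

-- Profiles: the values of a point at four distinguished coordinates.
Profile : Set
Profile = ℤ × ℤ × ℤ × ℤ

_+ᵖ_ _-ᵖ_ : Profile → Profile → Profile
(a , b , c , d) +ᵖ (a′ , b′ , c′ , d′) = a + a′ , b + b′ , c + c′ , d + d′
(a , b , c , d) -ᵖ (a′ , b′ , c′ , d′) = a - a′ , b - b′ , c - c′ , d - d′

Σᵖ σᵖ : Profile → ℤ
Σᵖ (a , b , c , d) = (a + b) + (c + d)
σᵖ (a , b , c , d) = a + b

All01 : Profile → Set
All01 (a , b , c , d) = Is01 a × Is01 b × Is01 c × Is01 d

profile-≡ : ∀ {a b c d a′ b′ c′ d′ : ℤ} → a ≡ a′ → b ≡ b′ → c ≡ c′ → d ≡ d′ →
            (a , b , c , d) ≡ (a′ , b′ , c′ , d′)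
profile-≡ refl refl refl refl = refl

-- The profiles of w₁, w₂, w₃, w₄ on (s,t,m,l).
SquareProfile : Profile → Set
SquareProfile p = p ≡ (0ℤ , 1ℤ , 0ℤ , 1ℤ) ⊎ p ≡ (1ℤ , 0ℤ , 0ℤ , 1ℤ)
                ⊎ p ≡ (0ℤ , 1ℤ , 1ℤ , 0ℤ) ⊎ p ≡ (1ℤ , 0ℤ , 1ℤ , 0ℤ)

classify : ∀ p → All01 p → Σᵖ p ≡ + 2 → p ≢ (1ℤ , 1ℤ , 0ℤ , 0ℤ) →
           (σᵖ p ≡ 1ℤ × SquareProfile p) ⊎ σᵖ p ≡ 0ℤ
classify _ (inj₁ refl , inj₁ refl , inj₁ refl , inj₁ refl) () _
classify _ (inj₁ refl , inj₁ refl , inj₁ refl , inj₂ refl) () _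
classify _ (inj₁ refl , inj₁ refl , inj₂ refl , inj₁ refl) () _
classify _ (inj₁ refl , inj₁ refl , inj₂ refl , inj₂ refl) _  _ = inj₂ refl
classify _ (inj₁ refl , inj₂ refl , inj₁ refl , inj₁ refl) () _
classify _ (inj₁ refl , inj₂ refl , inj₁ refl , inj₂ refl) _  _ = inj₁ (refl , inj₁ refl)
classify _ (inj₁ refl , inj₂ refl , inj₂ refl , inj₁ refl) _  _ = inj₁ (refl , inj₂ (inj₂ (inj₁ refl)))
classify _ (inj₁ refl , inj₂ refl , inj₂ refl , inj₂ refl) () _
classify _ (inj₂ refl , inj₁ refl , inj₁ refl , inj₁ refl) () _
classify _ (inj₂ refl , inj₁ refl , inj₁ refl , inj₂ refl) _  _ = inj₁ (refl , inj₂ (inj₁ refl))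
classify _ (inj₂ refl , inj₁ refl , inj₂ refl , inj₁ refl) _  _ = inj₁ (refl , inj₂ (inj₂ (inj₂ refl)))
classify _ (inj₂ refl , inj₁ refl , inj₂ refl , inj₂ refl) () _
classify _ (inj₂ refl , inj₂ refl , inj₁ refl , inj₁ refl) _  p≢1100 = ⊥-elim (p≢1100 refl)
classify _ (inj₂ refl , inj₂ refl , inj₁ refl , inj₂ refl) () _
classify _ (inj₂ refl , inj₂ refl , inj₂ refl , inj₁ refl) () _
classify _ (inj₂ refl , inj₂ refl , inj₂ refl , inj₂ refl) () _

module Square {n r : ℕ} (M : Matroid n) (rank : HasRank M r) (B : Subset n) (B-basis : IsBasis M B)
  (s t m l : Fin n) (s≢m : s ≢ m) (t≢l : t ≢ l) (s≢t : s ≢ t) (m≢l : m ≢ l)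
  (P₂-vertex : IsVertex M (𝐞[ B ] ⊕ (𝐞 s ⊖ 𝐞 t)))
  (P₃-vertex : IsVertex M (𝐞[ B ] ⊕ (𝐞 m ⊖ 𝐞 l)))
  (P₄-vertex : IsVertex M ((𝐞[ B ] ⊕ (𝐞 s ⊖ 𝐞 t)) ⊕ (𝐞 m ⊖ 𝐞 l)))
  where

  b P₂ P₃ P₄ P₅ P₆ : Point n
  b  = 𝐞[ B ]
  P₂ = b ⊕ (𝐞 s ⊖ 𝐞 t)
  P₃ = b ⊕ (𝐞 m ⊖ 𝐞 l)
  P₄ = P₂ ⊕ (𝐞 m ⊖ 𝐞 l)
  P₅ = b ⊕ (𝐞 s ⊖ 𝐞 l)
  P₆ = b ⊕ (𝐞 m ⊖ 𝐞 t)

  Sq : Point n → Set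
  Sq u = u ≈ b ⊎ u ≈ P₂ ⊎ u ≈ P₃ ⊎ u ≈ P₄

  -- Since P₂ and P₃ are 0/1-vectors, B contains t and l but neither s nor m.
  b-at-s : b s ≡ 0ℤ
  b-at-s = up-01 (indicator-01 B s) (subst Is01 (shift-source b s≢t) (vertex-01 {M = M} P₂-vertex s))
  b-at-t : b t ≡ 1ℤ
  b-at-t = down-01 (indicator-01 B t) (subst Is01 (shift-target b s≢t) (vertex-01 {M = M} P₂-vertex t))
  b-at-m : b m ≡ 0ℤ
  b-at-m = up-01 (indicator-01 B m) (subst Is01 (shift-source b m≢l) (vertex-01 {M = M} P₃-vertex m))
  b-at-l : b l ≡ 1ℤ
  b-at-l = down-01 (indicator-01 B l) (subst Is01 (shift-target b m≢l) (vertex-01 {M = M} P₃-vertex l))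

  s≢l : s ≢ l
  s≢l s≡l = 0≢1 (trans (sym b-at-s) (trans (cong b s≡l) b-at-l))
  t≢m : t ≢ m
  t≢m t≡m = 0≢1 (trans (sym b-at-m) (trans (cong b (sym t≡m)) b-at-t))

  OnSquare OffSquare : Fin n → Set
  OnSquare  i = i ≡ s ⊎ i ≡ t ⊎ i ≡ m ⊎ i ≡ l
  OffSquare i = i ≢ s × i ≢ t × i ≢ m × i ≢ l

  at-s : OnSquare s
  at-s = inj₁ refl
  at-t : OnSquare t
  at-t = inj₂ (inj₁ refl)
  at-m : OnSquare m
  at-m = inj₂ (inj₂ (inj₁ refl))
  at-l : OnSquare l
  at-l = inj₂ (inj₂ (inj₂ refl))

  onSquare? : ∀ i → OnSquare i ⊎ OffSquare i
  onSquare? i with i ≟ s | i ≟ t | i ≟ m | i ≟ l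
  ... | yes i≡s | _       | _       | _       = inj₁ (inj₁ i≡s)
  ... | no _    | yes i≡t | _       | _       = inj₁ (inj₂ (inj₁ i≡t))
  ... | no _    | no _    | yes i≡m | _       = inj₁ (inj₂ (inj₂ (inj₁ i≡m)))
  ... | no _    | no _    | no _    | yes i≡l = inj₁ (inj₂ (inj₂ (inj₂ i≡l)))
  ... | no i≢s  | no i≢t  | no i≢m  | no i≢l  = inj₂ (i≢s , i≢t , i≢m , i≢l)

  unit-off : ∀ {i j} → OffSquare i → OnSquare j → 𝐞 j i ≡ 0ℤ
  unit-off (i≢s , _ , _ , _) (inj₁ refl)               = 𝐞-diff i≢s
  unit-off (_ , i≢t , _ , _) (inj₂ (inj₁ refl))        = 𝐞-diff i≢t
  unit-off (_ , _ , i≢m , _) (inj₂ (inj₂ (inj₁ refl))) = 𝐞-diff i≢m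
  unit-off (_ , _ , _ , i≢l) (inj₂ (inj₂ (inj₂ refl))) = 𝐞-diff i≢l

  _≈ₒ_ : Point n → Point n → Set
  x ≈ₒ y = ∀ i → OffSquare i → x i ≡ y i

  shift-outside : ∀ x {j k} → OnSquare j → OnSquare k → (x ⊕ (𝐞 j ⊖ 𝐞 k)) ≈ₒ x
  shift-outside x on-j on-k i off =
    trans (cong (_+_ (x i)) (cong₂ _-_ (unit-off off on-j) (unit-off off on-k))) (ℤ.+-identityʳ (x i))

  b≈ₒb : b ≈ₒ b
  b≈ₒb _ _ = refl
  P₂≈ₒb : P₂ ≈ₒ b
  P₂≈ₒb = shift-outside b at-s at-t
  P₃≈ₒb : P₃ ≈ₒ b
  P₃≈ₒb = shift-outside b at-m at-l
  P₄≈ₒb : P₄ ≈ₒ b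
  P₄≈ₒb i off = trans (shift-outside P₂ at-m at-l i off) (P₂≈ₒb i off)
  P₅≈ₒb : P₅ ≈ₒ b
  P₅≈ₒb = shift-outside b at-s at-l

  profile : Point n → Profile
  profile x = x s , x t , x m , x l

  profile-cong : ∀ {x y} → x ≈ y → profile x ≡ profile y
  profile-cong x≈y = profile-≡ (x≈y s) (x≈y t) (x≈y m) (x≈y l)

  profile-at : ∀ {x y i} → profile x ≡ profile y → OnSquare i → x i ≡ y i
  profile-at eq (inj₁ refl)               = cong proj₁ eq
  profile-at eq (inj₂ (inj₁ refl))        = cong (λ p → proj₁ (proj₂ p)) eq
  profile-at eq (inj₂ (inj₂ (inj₁ refl))) = cong (λ p → proj₁ (proj₂ (proj₂ p))) eq
  profile-at eq (inj₂ (inj₂ (inj₂ refl))) = cong (λ p → proj₂ (proj₂ (proj₂ p))) eq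

  coincide : ∀ {x y p} → x ≈ₒ b → y ≈ₒ b → profile x ≡ p → profile y ≡ p → x ≈ y
  coincide x≈ₒb y≈ₒb px≡p py≡p i with onSquare? i
  ... | inj₁ on  = profile-at (trans px≡p (sym py≡p)) on
  ... | inj₂ off = trans (x≈ₒb i off) (sym (y≈ₒb i off))

  differ : ∀ {x y p q} → profile x ≡ p → profile y ≡ q → p ≢ q → ¬ x ≈ y
  differ px≡p py≡q p≢q x≈y = p≢q (trans (sym px≡p) (trans (profile-cong x≈y) py≡q))

  profile-eₛ : profile (𝐞 s) ≡ (1ℤ , 0ℤ , 0ℤ , 0ℤ)
  profile-eₛ = profile-≡ (𝐞-same s) (𝐞-diff (≢-sym s≢t)) (𝐞-diff (≢-sym s≢m)) (𝐞-diff (≢-sym s≢l))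
  profile-eₜ : profile (𝐞 t) ≡ (0ℤ , 1ℤ , 0ℤ , 0ℤ)
  profile-eₜ = profile-≡ (𝐞-diff s≢t) (𝐞-same t) (𝐞-diff (≢-sym t≢m)) (𝐞-diff (≢-sym t≢l))
  profile-eₘ : profile (𝐞 m) ≡ (0ℤ , 0ℤ , 1ℤ , 0ℤ)
  profile-eₘ = profile-≡ (𝐞-diff s≢m) (𝐞-diff t≢m) (𝐞-same m) (𝐞-diff (≢-sym m≢l))
  profile-eₗ : profile (𝐞 l) ≡ (0ℤ , 0ℤ , 0ℤ , 1ℤ)
  profile-eₗ = profile-≡ (𝐞-diff s≢l) (𝐞-diff t≢l) (𝐞-diff m≢l) (𝐞-same l)

  profile-b : profile b ≡ (0ℤ , 1ℤ , 0ℤ , 1ℤ)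
  profile-b = profile-≡ b-at-s b-at-t b-at-m b-at-l

  profile-shift : ∀ x j k {p q r} → profile x ≡ p → profile (𝐞 j) ≡ q → profile (𝐞 k) ≡ r →
                  profile (x ⊕ (𝐞 j ⊖ 𝐞 k)) ≡ p +ᵖ (q -ᵖ r)
  profile-shift x j k refl refl refl = refl

  profile-P₂ : profile P₂ ≡ (1ℤ , 0ℤ , 0ℤ , 1ℤ)
  profile-P₂ = profile-shift b s t profile-b profile-eₛ profile-eₜ
  profile-P₃ : profile P₃ ≡ (0ℤ , 1ℤ , 1ℤ , 0ℤ)
  profile-P₃ = profile-shift b m l profile-b profile-eₘ profile-eₗ
  profile-P₄ : profile P₄ ≡ (1ℤ , 0ℤ , 1ℤ , 0ℤ)
  profile-P₄ = profile-shift P₂ m l profile-P₂ profile-eₘ profile-eₗ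
  profile-P₅ : profile P₅ ≡ (1ℤ , 1ℤ , 0ℤ , 0ℤ)
  profile-P₅ = profile-shift b s l profile-b profile-eₛ profile-eₗ
  profile-P₆ : profile P₆ ≡ (0ℤ , 0ℤ , 1ℤ , 1ℤ)
  profile-P₆ = profile-shift b m t profile-b profile-eₘ profile-eₜ

  square-vertex : ∀ u → Sq u → IsVertex M u
  square-vertex u (inj₁ u≈b)               = basis⇒vertex M B-basis (≈-sym u≈b)
  square-vertex u (inj₂ (inj₁ u≈P₂))        = vertex-resp {M = M} (≈-sym u≈P₂) P₂-vertex
  square-vertex u (inj₂ (inj₂ (inj₁ u≈P₃))) = vertex-resp {M = M} (≈-sym u≈P₃) P₃-vertex
  square-vertex u (inj₂ (inj₂ (inj₂ u≈P₄))) = vertex-resp {M = M} (≈-sym u≈P₄) P₄-vertex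

  P₅∉Sq : ¬ Sq P₅
  P₅∉Sq (inj₁ P₅≈b)               = differ profile-P₅ profile-b (λ ()) P₅≈b
  P₅∉Sq (inj₂ (inj₁ P₅≈P₂))        = differ profile-P₅ profile-P₂ (λ ()) P₅≈P₂
  P₅∉Sq (inj₂ (inj₂ (inj₁ P₅≈P₃))) = differ profile-P₅ profile-P₃ (λ ()) P₅≈P₃
  P₅∉Sq (inj₂ (inj₂ (inj₂ P₅≈P₄))) = differ profile-P₅ profile-P₄ (λ ()) P₅≈P₄

  P₆∉Sq : ¬ Sq P₆
  P₆∉Sq (inj₁ P₆≈b)               = differ profile-P₆ profile-b (λ ()) P₆≈b
  P₆∉Sq (inj₂ (inj₁ P₆≈P₂))        = differ profile-P₆ profile-P₂ (λ ()) P₆≈P₂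
  P₆∉Sq (inj₂ (inj₂ (inj₁ P₆≈P₃))) = differ profile-P₆ profile-P₃ (λ ()) P₆≈P₃
  P₆∉Sq (inj₂ (inj₂ (inj₂ P₆≈P₄))) = differ profile-P₆ profile-P₄ (λ ()) P₆≈P₄

  -- (⇒) If f cuts out the square face, then f_s = f_t and f_m = f_l (the
  -- square points have equal value), so f reaches its maximum on P₅ when
  -- f_l ≤ f_s and on P₆ otherwise; that point then cannot be a vertex.
  P₅-or-P₆-missing : IsFaceWithVertices4 M b P₂ P₃ P₄ → ¬ IsVertex M P₅ ⊎ ¬ IsVertex M P₆
  P₅-or-P₆-missing (f , face) = map missing-P₅ missing-P₆ (ℤ.≤-total (f l) (f s))
    where
    open ℤ.≤-Reasoning

    in-face : ∀ {w} → IsVertex M w → dot f b ≤ dot f w → Sq w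
    in-face = vertex-in-face {M = M} face four-respects (inj₁ ≈-refl)

    reaches : ∀ {j k} → f k ≤ f j → dot f b ≤ dot f (b ⊕ (𝐞 j ⊖ 𝐞 k))
    reaches {j} {k} fₖ≤fⱼ = begin
      dot f b                   ≡⟨ ℤ.+-identityʳ (dot f b) ⟨
      dot f b + 0ℤ              ≤⟨ ℤ.+-monoʳ-≤ (dot f b) (ℤ.i≤j⇒0≤j-i fₖ≤fⱼ) ⟩
      dot f b + (f j - f k)     ≡⟨ dot-shift f b j k ⟨
      dot f (b ⊕ (𝐞 j ⊖ 𝐞 k))   ∎

    level : ∀ {j k} → Sq (b ⊕ (𝐞 j ⊖ 𝐞 k)) → f j ≡ f k
    level {j} {k} on-square = ℤ.i-j≡0⇒i≡j (f j) (f k) (∙-cancelˡ (dot f b) _ _ (begin-equality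
      dot f b + (f j - f k)     ≡⟨ dot-shift f b j k ⟨
      dot f (b ⊕ (𝐞 j ⊖ 𝐞 k))   ≡⟨ face-level {M = M} face four-respects on-square (inj₁ ≈-refl) ⟩
      dot f b                   ≡⟨ ℤ.+-identityʳ (dot f b) ⟨
      dot f b + 0ℤ              ∎))

    missing-P₅ : f l ≤ f s → ¬ IsVertex M P₅
    missing-P₅ fₗ≤fₛ P₅-vertex = P₅∉Sq (in-face P₅-vertex (reaches fₗ≤fₛ))

    missing-P₆ : f s ≤ f l → ¬ IsVertex M P₆
    missing-P₆ fₛ≤fₗ P₆-vertex = P₆∉Sq (in-face P₆-vertex (reaches (begin
      f t   ≡⟨ level (inj₂ (inj₁ ≈-refl)) ⟨
      f s   ≤⟨ fₛ≤fₗ ⟩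
      f l   ≡⟨ level (inj₂ (inj₂ (inj₁ ≈-refl))) ⟨
      f m   ∎)))

  -- (⇐) When P₅ is not a vertex, c = 2c₀ + e_s + e_t (defined below) cuts out
  -- the square face.  First, the indicators of the square and of its complement:
  𝟙□ outside : Point n
  𝟙□ = (𝐞 s ⊕ 𝐞 t) ⊕ (𝐞 m ⊕ 𝐞 l)
  outside i = 1ℤ - 𝟙□ i

  profile-𝟙□ : profile 𝟙□ ≡ profile 𝟙
  profile-𝟙□ = cong₂ _+ᵖ_ (cong₂ _+ᵖ_ profile-eₛ profile-eₜ) (cong₂ _+ᵖ_ profile-eₘ profile-eₗ)

  outside-on : ∀ {i} → OnSquare i → outside i ≡ 0ℤ
  outside-on on = cong (_-_ 1ℤ) (profile-at {x = 𝟙□} {y = 𝟙} profile-𝟙□ on)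

  outside-off : ∀ {i} → OffSquare i → outside i ≡ 1ℤ
  outside-off off = cong (_-_ 1ℤ) (cong₂ _+_ (cong₂ _+_ (unit-off off at-s) (unit-off off at-t))
                                              (cong₂ _+_ (unit-off off at-m) (unit-off off at-l)))

  vanishing-agree : ∀ k → (∀ {i} → OnSquare i → k i ≡ 0ℤ) → ∀ {x y} → x ≈ₒ y → dot k x ≡ dot k y
  vanishing-agree k k-on {x} {y} x≈ₒy = dot-agree k x k y termwise
    where
    termwise : ∀ i → k i * x i ≡ k i * y i
    termwise i with onSquare? i
    ... | inj₁ on  = zero-coefficient (k-on on)
    ... | inj₂ off = cong (k i *_) (x≈ₒy i off)

  dot-𝟙□ : ∀ x → dot 𝟙□ x ≡ Σᵖ (profile x)
  dot-𝟙□ x = trans (dot-⊕ˡ _ _ x)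
    (cong₂ _+_ (trans (dot-⊕ˡ _ _ x) (cong₂ _+_ (dot-eˡ x s) (dot-eˡ x t)))
               (trans (dot-⊕ˡ _ _ x) (cong₂ _+_ (dot-eˡ x m) (dot-eˡ x l))))

  dot-𝟙-split : ∀ x → dot 𝟙 x ≡ dot 𝟙□ x + dot outside x
  dot-𝟙-split x =
    trans (dot-agree 𝟙 x (𝟙□ ⊕ outside) x (λ i → cong (_* x i) (split (𝟙□ i)))) (dot-⊕ˡ 𝟙□ outside x)
    where
    split : ∀ a → 1ℤ ≡ a + (1ℤ - a)
    split = solve-∀

  -- A basis agreeing with B outside the square has, like B, two elements on it.
  square-count : ∀ X → IsBasis M X → 𝐞[ X ] ≈ₒ b → Σᵖ (profile 𝐞[ X ]) ≡ + 2
  square-count X X-basis X≈ₒb = begin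
    Σᵖ (profile 𝐞[ X ])  ≡⟨ dot-𝟙□ 𝐞[ X ] ⟨
    dot 𝟙□ 𝐞[ X ]        ≡⟨ ∙-cancelʳ (dot outside 𝐞[ X ]) _ _ same-size ⟩
    dot 𝟙□ b             ≡⟨ dot-𝟙□ b ⟩
    Σᵖ (profile b)       ≡⟨ cong Σᵖ profile-b ⟩
    + 2                  ∎
    where
    open ≡-Reasoning
    same-size : dot 𝟙□ 𝐞[ X ] + dot outside 𝐞[ X ] ≡ dot 𝟙□ b + dot outside 𝐞[ X ]
    same-size = begin
      dot 𝟙□ 𝐞[ X ] + dot outside 𝐞[ X ] ≡⟨ dot-𝟙-split 𝐞[ X ] ⟨
      dot 𝟙 𝐞[ X ]                        ≡⟨ dot-𝟙 X ⟩
      + ∣ X ∣                              ≡⟨ cong +_ (trans (rank X X-basis) (sym (rank B B-basis))) ⟩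
      + ∣ B ∣                              ≡⟨ dot-𝟙 B ⟨
      dot 𝟙 b                             ≡⟨ dot-𝟙-split b ⟩
      dot 𝟙□ b + dot outside b            ≡⟨ cong (_+_ (dot 𝟙□ b)) (vanishing-agree outside outside-on X≈ₒb) ⟨
      dot 𝟙□ b + dot outside 𝐞[ X ]       ∎

  c₀ : Point n
  c₀ i = outside i * sign B i

  c₀-on : ∀ {i} → OnSquare i → c₀ i ≡ 0ℤ
  c₀-on {i} on = trans (cong (_* sign B i) (outside-on on)) (ℤ.*-zeroˡ (sign B i))

  c₀-off : ∀ {i} → OffSquare i → c₀ i ≡ sign B i
  c₀-off {i} off = trans (cong (_* sign B i) (outside-off off)) (ℤ.*-identityˡ (sign B i))

  c₀-termwise : ∀ X i → c₀ i * 𝐞[ X ] i ≤ c₀ i * b i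
  c₀-termwise X i with onSquare? i
  ... | inj₁ on  = ℤ.≤-reflexive (zero-coefficient (c₀-on on))
  ... | inj₂ off = subst (λ k → k * 𝐞[ X ] i ≤ k * b i) (sym (c₀-off off)) (sign-bound B X i)

  V : ℤ
  V = dot c₀ b

  c₀-bound : ∀ X → dot c₀ 𝐞[ X ] ≤ V
  c₀-bound X = dot-mono c₀ 𝐞[ X ] c₀ b (c₀-termwise X)

  c₀-tight : ∀ X → dot c₀ 𝐞[ X ] ≡ V → 𝐞[ X ] ≈ₒ b
  c₀-tight X eq i off = sign-tight B X i
    (subst (λ k → k * 𝐞[ X ] i ≡ k * b i) (c₀-off off) (dot-tight c₀ 𝐞[ X ] b (c₀-termwise X) eq i))

  c : Point n
  c = (c₀ ⊕ c₀) ⊕ (𝐞 s ⊕ 𝐞 t)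

  dot-c : ∀ x → dot c x ≡ (dot c₀ x + dot c₀ x) + σᵖ (profile x)
  dot-c x = trans (dot-⊕ˡ _ _ x)
    (cong₂ _+_ (dot-⊕ˡ c₀ c₀ x) (trans (dot-⊕ˡ (𝐞 s) (𝐞 t) x) (cong₂ _+_ (dot-eˡ x s) (dot-eˡ x t))))

  top : ℤ
  top = (V + V) + 1ℤ

  tight-value : ∀ {x k} → dot c₀ x ≡ V → σᵖ (profile x) ≡ k → dot c x ≡ (V + V) + k
  tight-value {x} x-tight σ≡k = trans (dot-c x) (cong₂ _+_ (cong₂ _+_ x-tight x-tight) σ≡k)

  square-value : ∀ {P} → P ≈ₒ b → σᵖ (profile P) ≡ 1ℤ → dot c P ≡ top
  square-value P≈ₒb σ≡1 = tight-value (vanishing-agree c₀ c₀-on P≈ₒb) σ≡1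

  c-on-square : ∀ u → Sq u → dot c u ≡ top
  c-on-square u (inj₁ u≈b) = trans (dot-cong c u≈b) (square-value b≈ₒb (cong σᵖ profile-b))
  c-on-square u (inj₂ (inj₁ u≈P₂)) = trans (dot-cong c u≈P₂) (square-value P₂≈ₒb (cong σᵖ profile-P₂))
  c-on-square u (inj₂ (inj₂ (inj₁ u≈P₃))) = trans (dot-cong c u≈P₃) (square-value P₃≈ₒb (cong σᵖ profile-P₃))
  c-on-square u (inj₂ (inj₂ (inj₂ u≈P₄))) = trans (dot-cong c u≈P₄) (square-value P₄≈ₒb (cong σᵖ profile-P₄))

  square-member : ∀ {x} → x ≈ₒ b → SquareProfile (profile x) → Sq x
  square-member x≈ₒb (inj₁ p)               = inj₁ (coincide x≈ₒb b≈ₒb p profile-b)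
  square-member x≈ₒb (inj₂ (inj₁ p))        = inj₂ (inj₁ (coincide x≈ₒb P₂≈ₒb p profile-P₂))
  square-member x≈ₒb (inj₂ (inj₂ (inj₁ p))) = inj₂ (inj₂ (inj₁ (coincide x≈ₒb P₃≈ₒb p profile-P₃)))
  square-member x≈ₒb (inj₂ (inj₂ (inj₂ p))) = inj₂ (inj₂ (inj₂ (coincide x≈ₒb P₄≈ₒb p profile-P₄)))

  loose-below : ∀ X → dot c₀ 𝐞[ X ] < V → dot c 𝐞[ X ] < top
  loose-below X D<V = subst (_< top) (sym (dot-c 𝐞[ X ]))
    (double-below D<V (sum01≤2 (indicator-01 X s) (indicator-01 X t)))

  profile-01 : ∀ X → All01 (profile 𝐞[ X ])
  profile-01 X = indicator-01 X s , indicator-01 X t , indicator-01 X m , indicator-01 X l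

  module WithoutP₅ (no-P₅ : ¬ IsVertex M P₅) where

    not-P₅ : ∀ X → IsBasis M X → 𝐞[ X ] ≈ₒ b → profile 𝐞[ X ] ≢ (1ℤ , 1ℤ , 0ℤ , 0ℤ)
    not-P₅ X X-basis X≈ₒb p≡ = no-P₅ (basis⇒vertex M X-basis (coincide X≈ₒb P₅≈ₒb p≡ profile-P₅))

    -- A c₀-maximal basis has two elements on the square but not both of s, t:
    -- it is a square point of value `top`, or has value `top − 1`.
    tight-bound : ∀ X → IsBasis M X → dot c₀ 𝐞[ X ] ≡ V → 𝐞[ X ] ≈ₒ b →
                  dot c 𝐞[ X ] ≤ top × (dot c 𝐞[ X ] ≡ top → Sq 𝐞[ X ])
    tight-bound X X-basis D≡V X≈ₒb
      with classify (profile 𝐞[ X ]) (profile-01 X) (square-count X X-basis X≈ₒb) (not-P₅ X X-basis X≈ₒb)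
    ... | inj₁ (σ≡1 , square) = ℤ.≤-reflexive (tight-value D≡V σ≡1) , λ _ → square-member X≈ₒb square
    ... | inj₂ σ≡0 =
      strictly-below (subst (_< top) (sym (tight-value D≡V σ≡0)) (ℤ.+-monoʳ-< (V + V) (+<+ (s≤s z≤n))))

    c-bound : ∀ X → IsBasis M X → dot c 𝐞[ X ] ≤ top × (dot c 𝐞[ X ] ≡ top → Sq 𝐞[ X ])
    c-bound X X-basis with dot c₀ 𝐞[ X ] ℤ.≟ V
    ... | no D≢V  = strictly-below (loose-below X (ℤ.≤∧≢⇒< (c₀-bound X) D≢V))
    ... | yes D≡V = tight-bound X X-basis D≡V (c₀-tight X D≡V)

    square-face : IsFaceWithVertices4 M b P₂ P₃ P₄
    square-face = c , face-criterion M c Sq top c-bound c-on-square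
                        (λ u u∈Sq → vertex⇒basis {M = M} (square-vertex u u∈Sq)) (inj₁ ≈-refl)

-- The theorem for the square configuration at a basis B.  If P₆ is not a
-- vertex we use the configuration with (s,t) and (m,l) exchanged, whose P₅ is P₆.
square-theorem : ∀ {n r : ℕ} (M : Matroid n) → HasRank M r → ∀ B → IsBasis M B → (s t m l : Fin n) →
  s ≢ m → t ≢ l → s ≢ t → m ≢ l →
  IsVertex M (𝐞[ B ] ⊕ (𝐞 s ⊖ 𝐞 t)) → IsVertex M (𝐞[ B ] ⊕ (𝐞 m ⊖ 𝐞 l)) →
  IsVertex M ((𝐞[ B ] ⊕ (𝐞 s ⊖ 𝐞 t)) ⊕ (𝐞 m ⊖ 𝐞 l)) →
  IsFaceWithVertices4 M 𝐞[ B ] (𝐞[ B ] ⊕ (𝐞 s ⊖ 𝐞 t)) (𝐞[ B ] ⊕ (𝐞 m ⊖ 𝐞 l))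
                             ((𝐞[ B ] ⊕ (𝐞 s ⊖ 𝐞 t)) ⊕ (𝐞 m ⊖ 𝐞 l))
    ⇔ (¬ IsVertex M (𝐞[ B ] ⊕ (𝐞 s ⊖ 𝐞 l)) ⊎ ¬ IsVertex M (𝐞[ B ] ⊕ (𝐞 m ⊖ 𝐞 t)))
square-theorem M rank B B-basis s t m l s≢m t≢l s≢t m≢l P₂-vertex P₃-vertex P₄-vertex =
  mk⇔ S.P₅-or-P₆-missing square-face
  where
  module S = Square M rank B B-basis s t m l s≢m t≢l s≢t m≢l P₂-vertex P₃-vertex P₄-vertex

  P₄-exchanged : S.P₄ ≈ ((S.b ⊕ (𝐞 m ⊖ 𝐞 l)) ⊕ (𝐞 s ⊖ 𝐞 t))
  P₄-exchanged i = swap-last (S.b i) _ _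
    where
    swap-last : ∀ a p q → (a + p) + q ≡ (a + q) + p
    swap-last = solve-∀

  module S′ = Square M rank B B-basis m l s t (≢-sym s≢m) (≢-sym t≢l) m≢l s≢t P₃-vertex P₂-vertex
                (vertex-resp {M = M} P₄-exchanged P₄-vertex)

  square-face : ¬ IsVertex M S.P₅ ⊎ ¬ IsVertex M S.P₆ → IsFaceWithVertices4 M S.b S.P₂ S.P₃ S.P₄
  square-face (inj₁ no-P₅) = S.WithoutP₅.square-face no-P₅
  square-face (inj₂ no-P₆) = Equivalence.to (face4-resp {M = M} ≈-refl ≈-refl ≈-refl (≈-sym P₄-exchanged))
                               (face4-swap {M = M} (S′.WithoutP₅.square-face no-P₆))

-- Write w₁ = e_B; then w₁,…,w₆ are ≈ to the points of the square
-- configuration at B, and both sides of the equivalence are invariant under ≈.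
mainTheorem15 : ∀ {n r : ℕ} (M : Matroid n) → HasRank M r →
    (w₁ w₂ w₃ w₄ : Point n) (s t m l : Fin n) →
    IsVertex M w₁ → IsVertex M w₂ → IsVertex M w₃ → IsVertex M w₄ →
    Adjacent M w₁ w₂ → Adjacent M w₁ w₃ → Adjacent M w₄ w₂ → Adjacent M w₄ w₃ →
    w₂ ≈ (w₁ ⊕ (𝐞 s ⊖ 𝐞 t)) →
    w₃ ≈ (w₁ ⊕ (𝐞 m ⊖ 𝐞 l)) →
    w₄ ≈ ((w₁ ⊕ (𝐞 s ⊖ 𝐞 t)) ⊕ (𝐞 m ⊖ 𝐞 l)) →
    s ≢ m → t ≢ l → s ≢ t → m ≢ l →
    (IsFaceWithVertices4 M w₁ w₂ w₃ w₄ ⇔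
      (¬ IsVertex M (w₁ ⊕ (𝐞 s ⊖ 𝐞 l)) ⊎ ¬ IsVertex M (w₁ ⊕ (𝐞 m ⊖ 𝐞 t))))
mainTheorem15 {n} M rank w₁ w₂ w₃ w₄ s t m l w₁-vertex w₂-vertex w₃-vertex w₄-vertex _ _ _ _
  w₂≈ w₃≈ w₄≈ s≢m t≢l s≢t m≢l with vertex⇒basis {M = M} w₁-vertex
... | B , B-basis , b≈w₁ =
  ⇔.trans (face4-resp {M = M} w₁≈b w₂≈P₂ w₃≈P₃ w₄≈P₄)
    (⇔.trans (square-theorem M rank B B-basis s t m l s≢m t≢l s≢t m≢l
               (vertex-resp {M = M} w₂≈P₂ w₂-vertex) (vertex-resp {M = M} w₃≈P₃ w₃-vertex)
               (vertex-resp {M = M} w₄≈P₄ w₄-vertex))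
      (¬vertex-⇔ {M = M} (⊕-congˡ _ b≈w₁) ⊎-⇔ ¬vertex-⇔ {M = M} (⊕-congˡ _ b≈w₁)))
  where
  b : Point n
  b = 𝐞[ B ]
  w₁≈b : w₁ ≈ b
  w₁≈b = ≈-sym b≈w₁
  w₂≈P₂ : w₂ ≈ (b ⊕ (𝐞 s ⊖ 𝐞 t))
  w₂≈P₂ = ≈-trans w₂≈ (⊕-congˡ _ w₁≈b)
  w₃≈P₃ : w₃ ≈ (b ⊕ (𝐞 m ⊖ 𝐞 l))
  w₃≈P₃ = ≈-trans w₃≈ (⊕-congˡ _ w₁≈b)
  w₄≈P₄ : w₄ ≈ ((b ⊕ (𝐞 s ⊖ 𝐞 t)) ⊕ (𝐞 m ⊖ 𝐞 l))
  w₄≈P₄ = ≈-trans w₄≈ (⊕-congˡ _ (⊕-congˡ _ w₁≈b))
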